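{- Let $G_c$ be a graph on $c$ vertices with minimum degree at least 2 which is $(c+1)$-closed and not Hamiltonian-connected, and suppose $e(G_c)>h(c+1,\lfloor c/2\rfloor-p)$ for some integer $p\geq 0$. Then one of the following holds: (i) $G_c$ contains a set $S$ of $s-1$ vertices each of degree at most $s$, for some $2\leq s\leq\lfloor c/2\rfloor-p-1$, such that $G_c-S$ is a clique; or (ii) $G_c$ contains a set $T$ of $t-1$ vertices each of degree at most $t$, for some $\lfloor c/2\rfloor-p+1\leq t\leq\lfloor c/2\rfloor$.
   Context: Graphs are simple and finite. A graph on $m$ vertices is $m'$-closed if no two nonadjacent vertices have degree sum at least $m'$. A graph is Hamiltonian-connected if for any two vertices $x,y$ there is an $(x,y)$-path through all vertices. $h(n,k)=\binom{n-k}{2}+k(k-1)$. -}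

module Defs where

open import Data.Nat using (ℕ; zero; suc; _+_; _*_; _∸_; _≤_; _<_)
open import Data.Nat.Combinatorics using (_C_)
open import Data.Bool using (Bool; true; false; if_then_else_)
open import Data.Fin using (Fin; toℕ)
open import Data.Fin.Subset using (Subset; _∈_; _∉_; ∣_∣)
open import Data.Nat.ListAction using (sum)
open import Data.List using (List; []; _∷_; map; length; head; last; allFin; filter)
open import Data.List.Relation.Unary.Unique.Propositional using (Unique)
open import Data.List.Relation.Unary.Linked using (Linked)
open import Data.Maybe using (Maybe; just)
open import Relation.Binary.PropositionalEquality using (_≡_; _≢_)
open import Relation.Nullary using (¬_)

record Graph (n : ℕ) : Set where
  field
    adj   : Fin n → Fin n → Bool
    sym   : ∀ u v → adj u v ≡ adj v u
    irrefl : ∀ v → adj v v ≡ false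
open Graph public

Adj : ∀ {n} → Graph n → Fin n → Fin n → Set
Adj G u v = adj G u v ≡ true

b2n : Bool → ℕ
b2n true = 1
b2n false = 0

deg : ∀ {n} → Graph n → Fin n → ℕ
deg {n} G v = sum (map (λ u → b2n (adj G v u)) (allFin n))

edges : ∀ {n} → Graph n → ℕ
edges {n} G = sum (map (λ u → sum (map (λ v → if toℕ u Data.Nat.<ᵇ toℕ v then b2n (adj G u v) else 0) (allFin n))) (allFin n))

minDegAtLeast : ∀ {n} → Graph n → ℕ → Set
minDegAtLeast G d = ∀ v → d ≤ deg G v

Closed : ∀ {n} → ℕ → Graph n → Set
Closed m' G = ∀ u v → u ≢ v → ¬ Adj G u v → deg G u + deg G v < m'

HamPath : ∀ {n} → Graph n → Fin n → Fin n → Set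
HamPath {n} G x y = Data.Product.Σ (List (Fin n)) λ P →
  Unique P Data.Product.× length P ≡ n Data.Product.× head P ≡ just x
  Data.Product.× last P ≡ just y Data.Product.× Linked (Adj G) P
  where import Data.Product

HamiltonianConnected : ∀ {n} → Graph n → Set
HamiltonianConnected G = ∀ x y → x ≢ y → HamPath G x y

h : ℕ → ℕ → ℕ
h n k = ((n ∸ k) C 2) + k * (k ∸ 1)

CliqueOutside : ∀ {n} → Graph n → Subset n → Set
CliqueOutside G S = ∀ u v → u ∉ S → v ∉ S → u ≢ v → Adj G u v

SmallDegSet : ∀ {n} → Graph n → ℕ → Subset n → Set
SmallDegSet G s S = (∣ S ∣ ≡ s ∸ 1) Data.Product.× (∀ v → v ∈ S → deg G v ≤ s)
  where import Data.Product

-- Unless G is complete (and so trivially Hamiltonian-connected), pick nonadjacent u, z with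
-- deg u ≤ deg z, maximising first t = deg u and then deg z. Every nonadjacent pair then has an
-- endpoint of degree ≤ t, so the complement of the set L of vertices of degree ≤ t is a clique,
-- and every non-neighbour of z other than z lies in L. Closedness gives t + deg z ≤ c, hence
-- t ≤ |L| + 1 and t ≤ ⌊c/2⌋. With q = c − |L|, every edge meets L or joins two of the q other
-- vertices, and every vertex has degree < c, so 2e ≤ 2|L|t + q(q − 1) and 2e ≤ |L|t + q(c − 1).
-- Comparing |L| + 1 and t with k = ⌊c/2⌋ − p, either L or a subset of it is the set required in
-- (i) or (ii), or one of the two bounds gives e ≤ h(c + 1, k).
module Submission where

open import Defs hiding (sym)
open import Data.Nat using (ℕ; zero; suc; _+_; _*_; _∸_; _≤_; _<_; _≤?_; _≤ᵇ_; _<ᵇ_; z≤n; s≤s; ⌊_/2⌋)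
open import Data.Nat.Properties renaming (_≟_ to _≟ℕ_)
open import Data.Nat.Combinatorics using (_C_; nC1≡n; nCk+nC[k+1]≡[n+1]C[k+1])
open import Data.Nat.Tactic.RingSolver using (solve-∀)
import Data.Nat.ListAction as ListAction
open import Algebra.Properties.Semiring.Sum +-*-semiring
  using (sum; sum-syntax; ∑-distrib-+; ∑-comm; *-distribˡ-sum; *-distribʳ-sum; sum-cong-≗)
open import Data.Bool using (Bool; true; false; not; if_then_else_)
open import Data.Bool.Properties using (T-≡)
import Data.Bool.Properties as Bool
open import Data.Fin using (Fin; zero; suc; toℕ; fromℕ; _≟_)
open import Data.Fin.Permutation using (Permutation′; _⟨$⟩ʳ_; _⟨$⟩ˡ_; inverseˡ; transpose; _∘ₚ_)
import Data.Fin.Permutation.Components as PC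
open import Data.Fin.Subset using (Subset; _∈_; _∉_; _⊆_; ∣_∣; inside; outside; ⊥)
open import Data.Fin.Subset.Properties using (⊆-min; ∣⊥∣≡0; out⊆; in⊆in)
open import Data.Vec using (_∷_)
import Data.Vec as Vec
open import Data.Vec.Properties using (lookup∘tabulate; []=⇒lookup; lookup⇒[]=)
open import Data.List using (List; []; _∷_; map; allFin; tabulate; last; cartesianProduct)
open import Data.List.Properties using (map-tabulate; map-cong; length-tabulate)
open import Data.List.Membership.Propositional using () renaming (_∈_ to _∈ˡ_)
open import Data.List.Membership.Propositional.Properties using (∈-allFin; ∈-cartesianProduct⁺)
open import Data.List.Relation.Unary.Any using (here; there)
open import Data.List.Relation.Unary.Unique.Propositional.Properties using (tabulate⁺)
import Data.List.Relation.Unary.Linked as Linked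
open import Data.List.Relation.Unary.Linked.Properties using (AllPairs⇒Linked)
open import Data.Maybe using (just)
open import Data.Product using (_×_; _,_; proj₁; proj₂; ∃-syntax)
open import Data.Sum using (_⊎_; inj₁; inj₂)
open import Data.Empty using (⊥-elim)
open import Function using (_∘_; id; Equivalence)
open import Relation.Nullary using (¬_; does; yes; no; contradiction)
open import Relation.Nullary.Decidable using (_×-dec_; ¬?; dec-true; dec-false)
open import Relation.Unary using (Decidable)
open import Relation.Binary.PropositionalEquality

∑-mono-≤ : ∀ {n} {f g : Fin n → ℕ} → (∀ i → f i ≤ g i) → sum f ≤ sum g
∑-mono-≤ {zero}  f≤g = z≤n
∑-mono-≤ {suc n} f≤g = +-mono-≤ (f≤g zero) (∑-mono-≤ (f≤g ∘ suc))

term≤∑ : ∀ {n} (f : Fin n → ℕ) i → f i ≤ sum f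
term≤∑ f zero    = m≤m+n (f zero) _
term≤∑ f (suc i) = ≤-trans (term≤∑ (f ∘ suc) i) (m≤n+m _ (f zero))

∑-const : ∀ n c → ∑[ i < n ] c ≡ n * c
∑-const zero    c = refl
∑-const (suc n) c = cong (c +_) (∑-const n c)

∑-[≟] : ∀ {n} (i : Fin n) → ∑[ j < n ] b2n (does (i ≟ j)) ≡ 1
∑-[≟] {suc n} zero    = cong suc (trans (∑-const n 0) (*-zeroʳ n))
∑-[≟] {suc n} (suc i) = ∑-[≟] i

𝟙 : ∀ {n} → (Fin n → Bool) → Fin n → ℕ
𝟙 P i = b2n (P i)

count : ∀ {n} → (Fin n → Bool) → ℕ
count {n} P = ∑[ i < n ] 𝟙 P i

count-not+count≡n : ∀ {n} (P : Fin n → Bool) → count (not ∘ P) + count P ≡ n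
count-not+count≡n {n} P = begin
  count (not ∘ P) + count P          ≡⟨ ∑-distrib-+ (𝟙 (not ∘ P)) (𝟙 P) ⟨
  ∑[ i < n ] (𝟙 (not ∘ P) i + 𝟙 P i)  ≡⟨ sum-cong-≗ (λ i → one (P i)) ⟩
  ∑[ i < n ] 1                       ≡⟨ trans (∑-const n 1) (*-identityʳ n) ⟩
  n                                  ∎
  where
  open ≡-Reasoning
  one : ∀ b → b2n (not b) + b2n b ≡ 1
  one true  = refl
  one false = refl

sum-tabulate : ∀ {n} (f : Fin n → ℕ) → ListAction.sum (tabulate f) ≡ sum f
sum-tabulate {zero}  f = refl
sum-tabulate {suc n} f = cong (f zero +_) (sum-tabulate (f ∘ suc))

sum-map-allFin : ∀ n (f : Fin n → ℕ) → ListAction.sum (map f (allFin n)) ≡ sum f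
sum-map-allFin n f = trans (cong ListAction.sum (map-tabulate id f)) (sum-tabulate f)

∑-upper+diagonal : ∀ {n} (g : Fin n → Fin n → ℕ) → (∀ u v → g u v ≡ g v u) →
  2 * ∑[ u < n ] ∑[ v < n ] (if toℕ u <ᵇ toℕ v then g u v else 0) + ∑[ u < n ] g u u
  ≡ ∑[ u < n ] ∑[ v < n ] g u v
∑-upper+diagonal {zero}  g g-sym = refl
∑-upper+diagonal {suc n} g g-sym = begin
  2 * (row + U g′) + (g zero zero + D g′)
    ≡⟨ regroup row (U g′) (g zero zero) (D g′) ⟩
  (g zero zero + row) + (row + (2 * U g′ + D g′))
    ≡⟨ cong (λ x → (g zero zero + row) + (x + (2 * U g′ + D g′))) (sum-cong-≗ (λ v → g-sym zero (suc v))) ⟩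
  (g zero zero + row) + (col + (2 * U g′ + D g′))
    ≡⟨ cong (λ x → (g zero zero + row) + (col + x)) (∑-upper+diagonal g′ (λ u v → g-sym (suc u) (suc v))) ⟩
  (g zero zero + row) + (col + F g′)
    ≡⟨ cong ((g zero zero + row) +_) (∑-distrib-+ (λ u → g (suc u) zero) _) ⟨
  F g ∎
  where
  open ≡-Reasoning
  U D F : ∀ {m} → (Fin m → Fin m → ℕ) → ℕ
  U {m} f = ∑[ u < m ] ∑[ v < m ] (if toℕ u <ᵇ toℕ v then f u v else 0)
  D {m} f = ∑[ u < m ] f u u
  F {m} f = ∑[ u < m ] ∑[ v < m ] f u v
  g′ : Fin n → Fin n → ℕ
  g′ u v = g (suc u) (suc v)
  row = ∑[ v < n ] g zero (suc v)
  col = ∑[ u < n ] g (suc u) zero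
  regroup : ∀ r u a d → 2 * (r + u) + (a + d) ≡ (a + r) + (r + (2 * u + d))
  regroup = solve-∀

∑²-distrib-+ : ∀ {n m} (f g : Fin n → Fin m → ℕ) →
  ∑[ u < n ] ∑[ v < m ] (f u v + g u v) ≡ ∑[ u < n ] ∑[ v < m ] f u v + ∑[ u < n ] ∑[ v < m ] g u v
∑²-distrib-+ {m = m} f g = trans (sum-cong-≗ (λ u → ∑-distrib-+ (f u) (g u)))
                                 (∑-distrib-+ (λ u → ∑[ v < m ] f u v) (λ u → ∑[ v < m ] g u v))

∑²-factorˡ : ∀ {n m} (x : Fin n → ℕ) (f : Fin n → Fin m → ℕ) →
  ∑[ u < n ] ∑[ v < m ] (x u * f u v) ≡ ∑[ u < n ] (x u * ∑[ v < m ] f u v)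
∑²-factorˡ x f = sum-cong-≗ (λ u → sym (*-distribˡ-sum (x u) (f u)))

⊆-ofSize : ∀ {n} (p : Subset n) r → r ≤ ∣ p ∣ → ∃[ q ] (q ⊆ p × ∣ q ∣ ≡ r)
⊆-ofSize {n} p zero _ = ⊥ , ⊆-min p , ∣⊥∣≡0 n
⊆-ofSize (inside ∷ p) (suc r) r<∣p∣ with ⊆-ofSize p r (≤-pred r<∣p∣)
... | q , q⊆p , ∣q∣≡r = inside ∷ q , in⊆in q⊆p , cong suc ∣q∣≡r
⊆-ofSize (outside ∷ p) (suc r) r<∣p∣ with ⊆-ofSize p (suc r) r<∣p∣
... | q , q⊆p , ∣q∣≡r = outside ∷ q , out⊆ q⊆p , ∣q∣≡r

∈-tabulate⁻ : ∀ {n} (P : Fin n → Bool) {w} → w ∈ Vec.tabulate P → P w ≡ true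
∈-tabulate⁻ P {w} w∈ = trans (sym (lookup∘tabulate P w)) ([]=⇒lookup w∈)

∉-tabulate⁻ : ∀ {n} (P : Fin n → Bool) {w} → w ∉ Vec.tabulate P → P w ≡ false
∉-tabulate⁻ P {w} w∉ with P w in Pw
... | true  = contradiction (lookup⇒[]= w (Vec.tabulate P) (trans (lookup∘tabulate P w) Pw)) w∉
... | false = refl

∣tabulate∣≡count : ∀ {n} (P : Fin n → Bool) → ∣ Vec.tabulate P ∣ ≡ count P
∣tabulate∣≡count {zero}  P = refl
∣tabulate∣≡count {suc n} P with P zero
... | true  = cong suc (∣tabulate∣≡count (P ∘ suc))
... | false = ∣tabulate∣≡count (P ∘ suc)

Complete : ∀ {n} → Graph n → Set
Complete G = ∀ u v → u ≢ v → Adj G u v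

last-tabulate : ∀ {A : Set} n (f : Fin (suc n) → A) → last (tabulate f) ≡ just (f (fromℕ n))
last-tabulate zero    f = refl
last-tabulate (suc n) f = last-tabulate n (λ i → f (suc i))

permutation⇒hamPath : ∀ {n} (G : Graph (suc n)) → Complete G →
                      (π : Permutation′ (suc n)) → HamPath G (π ⟨$⟩ʳ zero) (π ⟨$⟩ʳ fromℕ n)
permutation⇒hamPath {n} G complete π =
  tabulate (π ⟨$⟩ʳ_) , distinct , length-tabulate (π ⟨$⟩ʳ_) , refl , last-tabulate n (π ⟨$⟩ʳ_) ,
  Linked.map (λ {u} {v} → complete u v) (AllPairs⇒Linked distinct)
  where
  injective : ∀ {i j} → π ⟨$⟩ʳ i ≡ π ⟨$⟩ʳ j → i ≡ j
  injective {i} {j} eq = trans (sym (inverseˡ π)) (trans (cong (π ⟨$⟩ˡ_) eq) (inverseˡ π))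
  distinct = tabulate⁺ injective

transpose-matchˡ : ∀ {n} (i j : Fin n) → PC.transpose i j i ≡ j
transpose-matchˡ i j rewrite dec-true (i ≟ i) refl = refl

transpose-other : ∀ {n} (i j k : Fin n) → k ≢ i → k ≢ j → PC.transpose i j k ≡ k
transpose-other i j k k≢i k≢j rewrite dec-false (k ≟ i) k≢i | dec-false (k ≟ j) k≢j = refl

endpoints-permutation : ∀ {n} (x y : Fin (suc (suc n))) → x ≢ y →
  ∃[ π ] (π ⟨$⟩ʳ zero ≡ x × π ⟨$⟩ʳ fromℕ (suc n) ≡ y)
endpoints-permutation {n} x y x≢y = transpose (fromℕ (suc n)) z ∘ₚ transpose zero x , π-zero , π-last
  where
  z = PC.transpose x zero y  -- swapping zero and x sends z to y
  z≢zero : zero ≢ z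
  z≢zero 0≡z = x≢y (trans (sym (transpose-matchˡ zero x))
                          (trans (cong (PC.transpose zero x) 0≡z) (PC.transpose-inverse zero x)))
  π-zero : PC.transpose zero x (PC.transpose (fromℕ (suc n)) z zero) ≡ x
  π-zero rewrite transpose-other (fromℕ (suc n)) z zero (λ ()) z≢zero = transpose-matchˡ zero x
  π-last : PC.transpose zero x (PC.transpose (fromℕ (suc n)) z (fromℕ (suc n))) ≡ y
  π-last rewrite transpose-matchˡ (fromℕ (suc n)) z = PC.transpose-inverse zero x

complete⇒hamiltonianConnected : ∀ {n} (G : Graph n) → Complete G → HamiltonianConnected G
complete⇒hamiltonianConnected {suc zero}    G complete zero zero x≢y = ⊥-elim (x≢y refl)
complete⇒hamiltonianConnected {suc (suc n)} G complete x y x≢y with endpoints-permutation x y x≢y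
... | π , refl , refl = permutation⇒hamPath G complete π

module _ {n : ℕ} (G : Graph n) where

  adjacency : Fin n → Fin n → ℕ
  adjacency u v = b2n (adj G u v)

  deg≡∑ : ∀ v → deg G v ≡ ∑[ u < n ] adjacency v u
  deg≡∑ v = sum-map-allFin n (adjacency v)

  handshake : 2 * edges G ≡ ∑[ v < n ] deg G v
  handshake = begin
    2 * edges G                              ≡⟨ cong (2 *_) edges≡ ⟩
    2 * upper                                ≡⟨ +-identityʳ (2 * upper) ⟨
    2 * upper + 0                            ≡⟨ cong (2 * upper +_) no-loops ⟨
    2 * upper + ∑[ u < n ] adjacency u u     ≡⟨ ∑-upper+diagonal adjacency (λ u v → cong b2n (Graph.sym G u v)) ⟩
    ∑[ u < n ] ∑[ v < n ] adjacency u v      ≡⟨ sum-cong-≗ (sym ∘ deg≡∑) ⟩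
    ∑[ v < n ] deg G v                       ∎
    where
    open ≡-Reasoning
    upper-row : Fin n → Fin n → ℕ
    upper-row u v = if toℕ u <ᵇ toℕ v then adjacency u v else 0
    upper = ∑[ u < n ] ∑[ v < n ] upper-row u v
    edges≡ : edges G ≡ upper
    edges≡ = trans (cong ListAction.sum (map-cong (λ u → sum-map-allFin n (upper-row u)) (allFin n)))
                   (sum-map-allFin n (λ u → ∑[ v < n ] upper-row u v))
    no-loops : ∑[ u < n ] adjacency u u ≡ 0
    no-loops = trans (sum-cong-≗ (λ u → cong b2n (irrefl G u))) (trans (∑-const n 0) (*-zeroʳ n))

  non-neighbours+deg≡n : ∀ v → count (not ∘ adj G v) + deg G v ≡ n
  non-neighbours+deg≡n v = trans (cong (count (not ∘ adj G v) +_) (deg≡∑ v)) (count-not+count≡n (adj G v))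

  deg<n : ∀ v → deg G v < n
  deg<n v = begin-strict
    deg G v                                           <⟨ +-monoˡ-≤ (deg G v) v∉N[v] ⟩
    count (not ∘ adj G v) + deg G v                   ≡⟨ non-neighbours+deg≡n v ⟩
    n                                                 ∎
    where
    open ≤-Reasoning
    v∉N[v] : 1 ≤ count (not ∘ adj G v)
    v∉N[v] = ≤-trans (≤-reflexive (cong (b2n ∘ not) (sym (irrefl G v)))) (term≤∑ (𝟙 (not ∘ adj G v)) v)

  module _ (L : Fin n → Bool) where

    degSum : ℕ
    degSum = ∑[ w < n ] (𝟙 L w * deg G w)

    edges≤degSum+pairs : 2 * edges G + count (not ∘ L) ≤ 2 * degSum + count (not ∘ L) * count (not ∘ L)
    edges≤degSum+pairs = begin
      2 * edges G + count (not ∘ L)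
        ≡⟨ cong₂ _+_ twice-edges loops ⟨
      ∑[ u < n ] ∑[ v < n ] adjacency u v + ∑[ u < n ] ∑[ v < n ] loop u v
        ≡⟨ ∑²-distrib-+ adjacency loop ⟨
      ∑[ u < n ] ∑[ v < n ] (adjacency u v + loop u v)
        ≤⟨ ∑-mono-≤ (λ u → ∑-mono-≤ (edge-covered u)) ⟩
      ∑[ u < n ] ∑[ v < n ] (row u v + col u v + pair u v)
        ≡⟨ trans (∑²-distrib-+ (λ u v → row u v + col u v) pair)
                 (cong (_+ ∑[ u < n ] ∑[ v < n ] pair u v) (∑²-distrib-+ row col)) ⟩
      ∑[ u < n ] ∑[ v < n ] row u v + ∑[ u < n ] ∑[ v < n ] col u v + ∑[ u < n ] ∑[ v < n ] pair u v
        ≡⟨ cong₂ _+_ (cong₂ _+_ rows (trans (∑-comm col) rows)) pairs ⟩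
      degSum + degSum + count (not ∘ L) * count (not ∘ L)
        ≡⟨ cong (λ x → degSum + x + count (not ∘ L) * count (not ∘ L)) (+-identityʳ degSum) ⟨
      2 * degSum + count (not ∘ L) * count (not ∘ L) ∎
      where
      open ≤-Reasoning
      δ loop row col pair : Fin n → Fin n → ℕ
      δ u v    = b2n (does (u ≟ v))
      loop u v = 𝟙 (not ∘ L) u * δ u v
      row u v  = 𝟙 L u * adjacency u v
      col u v  = 𝟙 L v * adjacency v u
      pair u v = 𝟙 (not ∘ L) u * 𝟙 (not ∘ L) v
      twice-edges : ∑[ u < n ] ∑[ v < n ] adjacency u v ≡ 2 * edges G
      twice-edges = trans (sum-cong-≗ (sym ∘ deg≡∑)) (sym handshake)
      loops : ∑[ u < n ] ∑[ v < n ] loop u v ≡ count (not ∘ L)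
      loops = trans (∑²-factorˡ (𝟙 (not ∘ L)) δ)
                    (sum-cong-≗ (λ u → trans (cong (𝟙 (not ∘ L) u *_) (∑-[≟] u)) (*-identityʳ _)))
      rows : ∑[ u < n ] ∑[ v < n ] row u v ≡ degSum
      rows = trans (∑²-factorˡ (𝟙 L) adjacency) (sum-cong-≗ (λ u → cong (𝟙 L u *_) (sym (deg≡∑ u))))
      pairs : ∑[ u < n ] ∑[ v < n ] pair u v ≡ count (not ∘ L) * count (not ∘ L)
      pairs = trans (∑²-factorˡ (𝟙 (not ∘ L)) (λ _ → 𝟙 (not ∘ L)))
                    (sym (*-distribʳ-sum (count (not ∘ L)) (𝟙 (not ∘ L))))
      edge-covered : ∀ u v → adjacency u v + loop u v ≤ row u v + col u v + pair u v
      edge-covered u v with u ≟ v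
      ... | yes refl rewrite irrefl G u with L u
      ...   | true  = z≤n
      ...   | false = ≤-refl
      edge-covered u v | no _ rewrite Graph.sym G v u with L u | L v | adj G u v
      ... | true  | _     | true  = s≤s z≤n
      ... | true  | _     | false = z≤n
      ... | false | true  | true  = s≤s z≤n
      ... | false | false | true  = ≤-refl
      ... | false | _     | false = z≤n

    edges≤degSum+degrees : 2 * edges G + count (not ∘ L) ≤ degSum + count (not ∘ L) * n
    edges≤degSum+degrees = begin
      2 * edges G + count (not ∘ L)
        ≡⟨ cong (_+ count (not ∘ L)) handshake ⟩
      ∑[ w < n ] deg G w + count (not ∘ L)
        ≡⟨ ∑-distrib-+ (deg G) (𝟙 (not ∘ L)) ⟨
      ∑[ w < n ] (deg G w + 𝟙 (not ∘ L) w)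
        ≤⟨ ∑-mono-≤ bounded ⟩
      ∑[ w < n ] (𝟙 L w * deg G w + 𝟙 (not ∘ L) w * n)
        ≡⟨ ∑-distrib-+ (λ w → 𝟙 L w * deg G w) (λ w → 𝟙 (not ∘ L) w * n) ⟩
      degSum + ∑[ w < n ] (𝟙 (not ∘ L) w * n)
        ≡⟨ cong (degSum +_) (*-distribʳ-sum n (𝟙 (not ∘ L))) ⟨
      degSum + count (not ∘ L) * n ∎
      where
      open ≤-Reasoning
      bounded : ∀ w → deg G w + 𝟙 (not ∘ L) w ≤ 𝟙 L w * deg G w + 𝟙 (not ∘ L) w * n
      bounded w with L w
      ... | true  = ≤-reflexive (cong (_+ 0) (sym (+-identityʳ (deg G w))))
      ... | false = subst (_≤ n + 0) (+-comm 1 (deg G w)) (≤-trans (deg<n w) (m≤m+n n 0))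

none⊎maximal : {X : Set} {P : X → Set} → Decidable P → (f : X → ℕ) (xs : List X) →
               (∀ x → x ∈ˡ xs → ¬ P x) ⊎ ∃[ x ] (P x × ∀ y → y ∈ˡ xs → P y → f y ≤ f x)
none⊎maximal P? f [] = inj₁ (λ _ ())
none⊎maximal P? f (x ∷ xs) with none⊎maximal P? f xs | P? x
... | inj₁ none | no ¬px = inj₁ λ { _ (here refl) → ¬px ; y (there y∈) → none y y∈ }
... | inj₁ none | yes px =
  inj₂ (x , px , λ { _ (here refl) _ → ≤-refl ; y (there y∈) py → contradiction py (none y y∈) })
... | inj₂ (b , pb , max) | no ¬px =
  inj₂ (b , pb , λ { _ (here refl) px → contradiction px ¬px ; y (there y∈) → max y y∈ })
... | inj₂ (b , pb , max) | yes px with f b ≤? f x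
...   | yes fb≤fx =
  inj₂ (x , px , λ { _ (here refl) _ → ≤-refl ; y (there y∈) py → ≤-trans (max y y∈ py) fb≤fx })
...   | no fb≰fx  =
  inj₂ (b , pb , λ { _ (here refl) _ → ≰⇒≥ fb≰fx ; y (there y∈) → max y y∈ })

-- u and z are nonadjacent with deg u ≤ deg z, chosen to maximise deg u and then deg z; only the
-- consequences of this choice that are used later are recorded.
record ExtremalPair {n : ℕ} (G : Graph n) : Set where
  field
    u z : Fin n
    u≢z : u ≢ z
    u≁z : adj G u z ≡ false
    deg-u≤deg-z : deg G u ≤ deg G z
    nonadjacent-low : ∀ a b → a ≢ b → adj G a b ≡ false → deg G a ≤ deg G u ⊎ deg G b ≤ deg G u
    non-neighbour-low : ∀ w → w ≢ z → adj G z w ≡ false → deg G w ≤ deg G u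

module _ {n : ℕ} (G : Graph n) where

  Candidate : Fin n × Fin n → Set
  Candidate (a , b) = a ≢ b × adj G a b ≡ false × deg G a ≤ deg G b

  candidate? : Decidable Candidate
  candidate? (a , b) = ¬? (a ≟ b) ×-dec (adj G a b Bool.≟ false) ×-dec (deg G a ≤? deg G b)

  orient : ∀ a b → a ≢ b → adj G a b ≡ false → Candidate (a , b) ⊎ Candidate (b , a)
  orient a b a≢b a≁b with deg G a ≤? deg G b
  ... | yes da≤db = inj₁ (a≢b , a≁b , da≤db)
  ... | no da≰db  = inj₂ (a≢b ∘ sym , trans (Graph.sym G b a) a≁b , ≰⇒≥ da≰db)

  pairs : List (Fin n × Fin n)
  pairs = cartesianProduct (allFin n) (allFin n)

  ∈-pairs : ∀ a b → (a , b) ∈ˡ pairs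
  ∈-pairs a b = ∈-cartesianProduct⁺ (∈-allFin a) (∈-allFin b)

  complete⊎extremalPair : Complete G ⊎ ExtremalPair G
  complete⊎extremalPair with none⊎maximal candidate? (deg G ∘ proj₁) pairs
  ... | inj₁ none = inj₁ complete
    where
    complete : Complete G
    complete u v u≢v with adj G u v in u∼v
    ... | true  = refl
    ... | false with orient u v u≢v u∼v
    ...   | inj₁ c = contradiction c (none _ (∈-pairs u v))
    ...   | inj₂ c = contradiction c (none _ (∈-pairs v u))
  ... | inj₂ (p₀ , p₀-candidate , max-low)
    with none⊎maximal (λ p → candidate? p ×-dec (deg G (proj₁ p) ≟ℕ deg G (proj₁ p₀)))
                      (deg G ∘ proj₂) pairs
  ...   | inj₁ none = contradiction (p₀-candidate , refl) (none p₀ (∈-pairs (proj₁ p₀) (proj₂ p₀)))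
  ...   | inj₂ ((u , z) , ((u≢z , u≁z , du≤dz) , du≡t) , max-high) = inj₂ record
    { u = u ; z = z ; u≢z = u≢z ; u≁z = u≁z ; deg-u≤deg-z = du≤dz
    ; nonadjacent-low = nonadjacent-low ; non-neighbour-low = non-neighbour-low }
    where
    first-low : ∀ a b → Candidate (a , b) → deg G a ≤ deg G u
    first-low a b c = subst (deg G a ≤_) (sym du≡t) (max-low (a , b) (∈-pairs a b) c)
    nonadjacent-low : ∀ a b → a ≢ b → adj G a b ≡ false → deg G a ≤ deg G u ⊎ deg G b ≤ deg G u
    nonadjacent-low a b a≢b a≁b with orient a b a≢b a≁b
    ... | inj₁ c = inj₁ (first-low a b c)
    ... | inj₂ c = inj₂ (first-low b a c)
    non-neighbour-low : ∀ w → w ≢ z → adj G z w ≡ false → deg G w ≤ deg G u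
    non-neighbour-low w w≢z z≁w with deg G w ≤? deg G z
    ... | yes dw≤dz = first-low w z (w≢z , trans (Graph.sym G w z) z≁w , dw≤dz)
    ... | no dw≰dz  = contradiction (max-high (z , w) (∈-pairs z w) (zw , dz≡t)) dw≰dz
      where
      zw : Candidate (z , w)
      zw = w≢z ∘ sym , z≁w , ≰⇒≥ dw≰dz
      dz≡t : deg G z ≡ deg G (proj₁ p₀)
      dz≡t = ≤-antisym (max-low (z , w) (∈-pairs z w) zw) (subst (_≤ deg G z) du≡t du≤dz)

≤-from-slack : ∀ {a b} s → a + s ≡ b → a ≤ b
≤-from-slack {a} s a+s≡b = ≤-trans (m≤m+n a s) (≤-reflexive a+s≡b)

twice-C2 : ∀ j → 2 * (j C 2) + j ≡ j * j
twice-C2 zero = refl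
twice-C2 (suc j) = begin
  2 * (suc j C 2) + suc j        ≡⟨ cong (λ x → 2 * x + suc j) (sym (nCk+nC[k+1]≡[n+1]C[k+1] j 1)) ⟩
  2 * (j C 1 + j C 2) + suc j    ≡⟨ cong (λ x → 2 * (x + j C 2) + suc j) (nC1≡n j) ⟩
  2 * (j + j C 2) + suc j        ≡⟨ regroup j (j C 2) ⟩
  (2 * (j C 2) + j) + suc (2 * j) ≡⟨ cong (_+ suc (2 * j)) (twice-C2 j) ⟩
  j * j + suc (2 * j)            ≡⟨ square-suc j ⟩
  suc j * suc j                  ∎
  where
  open ≡-Reasoning
  regroup : ∀ j x → 2 * (j + x) + suc j ≡ (2 * x + j) + suc (2 * j)
  regroup = solve-∀
  square-suc : ∀ j → j * j + suc (2 * j) ≡ suc j * suc j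
  square-suc = solve-∀

-- 2 h(j + k, k) = j(j − 1) + 2k(k − 1), with both sides moved so that no subtraction occurs.
twice-h : ∀ j k → 2 * h (j + k) k + j + 2 * k ≡ j * j + 2 * (k * k)
twice-h j k rewrite m+n∸n≡m j k = begin
  2 * (j C 2 + k * (k ∸ 1)) + j + 2 * k      ≡⟨ regroup (j C 2) (k * (k ∸ 1)) j k ⟩
  (2 * (j C 2) + j) + 2 * (k * (k ∸ 1) + k)  ≡⟨ cong₂ (λ x y → x + 2 * y) (twice-C2 j) (pred-square k) ⟩
  j * j + 2 * (k * k)                        ∎
  where
  open ≡-Reasoning
  regroup : ∀ a b j k → 2 * (a + b) + j + 2 * k ≡ (2 * a + j) + 2 * (b + k)
  regroup = solve-∀
  pred-square : ∀ k → k * (k ∸ 1) + k ≡ k * k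
  pred-square zero = refl
  pred-square (suc k) = square k
    where
    square : ∀ k → suc k * k + suc k ≡ suc k * suc k
    square = solve-∀

≤h[j+k,k] : ∀ {e j k} → 2 * e + j + 2 * k ≤ j * j + 2 * (k * k) → e ≤ h (j + k) k
≤h[j+k,k] {e} {j} {k} le = *-cancelˡ-≤ 2 (+-cancelʳ-≤ (j + 2 * k) (2 * e) (2 * h (j + k) k) (begin
  2 * e + (j + 2 * k)               ≡⟨ +-assoc (2 * e) j (2 * k) ⟨
  2 * e + j + 2 * k                 ≤⟨ le ⟩
  j * j + 2 * (k * k)               ≡⟨ twice-h j k ⟨
  2 * h (j + k) k + j + 2 * k       ≡⟨ +-assoc (2 * h (j + k) k) j (2 * k) ⟩
  2 * h (j + k) k + (j + 2 * k)     ∎))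
  where open ≤-Reasoning

≤h-when-k≡1+m : ∀ {e q m t} → t ≤ suc m → 2 * e + q ≤ 2 * (m * t) + q * q →
                e ≤ h (q + suc m) (suc m)
≤h-when-k≡1+m {e} {q} {m} {t} t≤1+m E = ≤h[j+k,k] {j = q} {k = suc m} (begin
  2 * e + q + 2 * suc m                ≤⟨ +-monoˡ-≤ (2 * suc m) E ⟩
  2 * (m * t) + q * q + 2 * suc m      ≤⟨ +-monoˡ-≤ (2 * suc m)
                                              (+-monoˡ-≤ (q * q) (*-monoʳ-≤ 2 (*-monoʳ-≤ m t≤1+m))) ⟩
  2 * (m * suc m) + q * q + 2 * suc m  ≡⟨ regroup m q ⟩
  q * q + 2 * (suc m * suc m)          ∎)
  where
  open ≤-Reasoning
  regroup : ∀ m q → 2 * (m * suc m) + q * q + 2 * suc m ≡ q * q + 2 * (suc m * suc m)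
  regroup = solve-∀

≤h-when-k≡m : ∀ {e q k t} → k ≤ q → t ≤ k → 2 * e + q ≤ 2 * (k * t) + q * q →
              e ≤ h (suc q + k) k
≤h-when-k≡m {e} {q} {k} {t} k≤q t≤k E = ≤h[j+k,k] {j = suc q} {k = k} (begin
  2 * e + suc q + 2 * k                ≡⟨ regroup e q k ⟩
  (2 * e + q) + suc (2 * k)            ≤⟨ +-monoˡ-≤ (suc (2 * k)) E ⟩
  2 * (k * t) + q * q + suc (2 * k)    ≤⟨ +-mono-≤ (+-monoˡ-≤ (q * q) (*-monoʳ-≤ 2 (*-monoʳ-≤ k t≤k)))
                                                   (s≤s (*-monoʳ-≤ 2 k≤q)) ⟩
  2 * (k * k) + q * q + suc (2 * q)    ≡⟨ square-suc k q ⟩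
  suc q * suc q + 2 * (k * k)          ∎)
  where
  open ≤-Reasoning
  regroup : ∀ e q k → 2 * e + suc q + 2 * k ≡ (2 * e + q) + suc (2 * k)
  regroup = solve-∀
  square-suc : ∀ k q → 2 * (k * k) + q * q + suc (2 * q) ≡ suc q * suc q + 2 * (k * k)
  square-suc = solve-∀

-- The low vertices number m = k + 1 + d and c = q + m, so c + 1 = (q + d + 2) + k; the parity of c
-- leaves only k = q + d and k = q + d + 1.
≤h-when-k<m : ∀ {e q d k t} → q + d ≤ k → k ≤ suc (q + d) → t ≤ k →
              2 * e + q ≤ suc (k + d) * t + q * (q + suc (k + d)) →
              e ≤ h (suc (suc (q + d)) + k) k
≤h-when-k<m {e} {q} {d} {k} {t} lo hi t≤k E =
  ≤h[j+k,k] {j = suc (suc (q + d))} {k = k} (+-cancelʳ-≤ q _ _ (begin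
  2 * e + j + 2 * k + q                                  ≡⟨ regroup e q j k ⟩
  (2 * e + q) + (j + 2 * k)                              ≤⟨ +-monoˡ-≤ (j + 2 * k) E ⟩
  suc (k + d) * t + q * (q + suc (k + d)) + (j + 2 * k)  ≤⟨ +-monoˡ-≤ (j + 2 * k)
                                                              (+-monoˡ-≤ _ (*-monoʳ-≤ (suc (k + d)) t≤k)) ⟩
  suc (k + d) * k + q * (q + suc (k + d)) + (j + 2 * k)  ≤⟨ bound (m≤n⇒m<n∨m≡n hi) ⟩
  j * j + 2 * (k * k) + q                                ∎))
  where
  open ≤-Reasoning
  j = suc (suc (q + d))
  regroup : ∀ e q j k → 2 * e + j + 2 * k + q ≡ (2 * e + q) + (j + 2 * k)
  regroup = solve-∀
  bound : k < suc (q + d) ⊎ k ≡ suc (q + d) →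
          suc (k + d) * k + q * (q + suc (k + d)) + (j + 2 * k) ≤ j * j + 2 * (k * k) + q
  bound (inj₁ k<) with ≤-antisym lo (≤-pred k<)
  ... | refl = ≤-from-slack (d * (q + d) + 2) (slack q d)
    where
    slack : ∀ q d → let s = q + d in
            suc (s + d) * s + q * (q + suc (s + d)) + (suc (suc s) + 2 * s) + (d * s + 2)
            ≡ suc (suc s) * suc (suc s) + 2 * (s * s) + q
    slack = solve-∀
  bound (inj₂ refl) = ≤-from-slack (d * (q + d) + q + d) (slack q d)
    where
    slack : ∀ q d → let s = q + d in
            suc (suc s + d) * suc s + q * (q + suc (suc s + d)) + (suc (suc s) + 2 * suc s) + (d * s + q + d)
            ≡ suc (suc s) * suc (suc s) + 2 * (suc s * suc s) + q
    slack = solve-∀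

≤h-at-half : ∀ {m q t e k} → k + k ≤ q + m → q + m ≤ suc (k + k) → k ≤ m → t ≤ k →
             2 * e + q ≤ 2 * (m * t) + q * q → 2 * e + q ≤ m * t + q * (q + m) →
             e ≤ h (q + m + 1) k
≤h-at-half {m} {q} {t} {e} {k} lo hi k≤m t≤k E₁ E₂ with m≤n⇒m<n∨m≡n k≤m
... | inj₂ refl = subst (λ n → e ≤ h n k) (shift q k) (≤h-when-k≡m k≤q t≤k E₁)
  where
  k≤q : k ≤ q
  k≤q = +-cancelʳ-≤ k k q lo
  shift : ∀ q k → suc q + k ≡ q + k + 1
  shift = solve-∀
... | inj₁ k<m with m≤n⇒∃[o]m+o≡n k<m
...   | d , refl = subst (λ n → e ≤ h n k) (shift q d k) (≤h-when-k<m q+d≤k k≤1+q+d t≤k E₂)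
  where
  shift : ∀ q d k → suc (suc (q + d)) + k ≡ q + suc (k + d) + 1
  shift = solve-∀
  regroup : ∀ q d k → q + suc (k + d) ≡ suc (q + d) + k
  regroup = solve-∀
  q+d≤k : q + d ≤ k
  q+d≤k = +-cancelʳ-≤ k (q + d) k (≤-pred (subst (_≤ suc (k + k)) (regroup q d k) hi))
  k≤1+q+d : k ≤ suc (q + d)
  k≤1+q+d = +-cancelʳ-≤ k k (suc (q + d)) (subst (k + k ≤_) (regroup q d k) lo)

threshold-cases : ∀ {c m q t e k K} → q + m ≡ c → K + K ≤ c → c ≤ suc (K + K) →
                  t ≤ suc m → t ≤ K → k ≤ K →
                  2 * e + q ≤ 2 * (m * t) + q * q → 2 * e + q ≤ m * t + q * c → h (c + 1) k < e →
                  suc (suc m) ≤ k ⊎ ∃[ r ] (k + 1 ≤ r × r ≤ K × t ≤ r × r ∸ 1 ≤ m)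
threshold-cases {m = m} {q} {t} {e} {k} {K} refl lo hi t≤1+m t≤K k≤K E₁ E₂ h<e with k + 1 ≤? t
... | yes k<t = inj₂ (t , k<t , t≤K , ≤-refl , ∸-monoˡ-≤ 1 t≤1+m)
... | no k≮t with suc (suc m) ≤? k
...   | yes m+2≤k = inj₁ m+2≤k
...   | no m+2≰k with m≤n⇒m<n∨m≡n (≮⇒≥ m+2≰k)
...     | inj₂ refl =
  contradiction (subst (λ n → e ≤ h n k) (shift q m) (≤h-when-k≡1+m t≤1+m E₁)) (<⇒≱ h<e)
  where
  shift : ∀ q m → q + suc m ≡ q + m + 1
  shift = solve-∀
...     | inj₁ k≤m with m≤n⇒m<n∨m≡n k≤K
...       | inj₁ k<K = inj₂ (suc k , ≤-reflexive (+-comm k 1) , k<K , <⇒≤ t<1+k , ≤-pred k≤m)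
  where
  t<1+k : t < suc k
  t<1+k = subst (t <_) (+-comm k 1) (≰⇒> k≮t)
...       | inj₂ refl = contradiction (≤h-at-half lo hi (≤-pred k≤m) t≤K E₁ E₂) (<⇒≱ h<e)

module _ {n : ℕ} (G : Graph n) (t : ℕ) where

  low : Fin n → Bool
  low w = deg G w ≤ᵇ t

  lowSet : Subset n
  lowSet = Vec.tabulate low

  low⇒deg≤ : ∀ {w} → low w ≡ true → deg G w ≤ t
  low⇒deg≤ {w} lw = ≤ᵇ⇒≤ (deg G w) t (Equivalence.from T-≡ lw)

  deg≤⇒low : ∀ {w} → deg G w ≤ t → low w ≡ true
  deg≤⇒low dw≤t = Equivalence.to T-≡ (≤⇒≤ᵇ dw≤t)

  ∈lowSet⇒deg≤ : ∀ {w} → w ∈ lowSet → deg G w ≤ t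
  ∈lowSet⇒deg≤ = low⇒deg≤ ∘ ∈-tabulate⁻ low

  degSum-low≤ : degSum G low ≤ count low * t
  degSum-low≤ = begin
    ∑[ w < n ] (𝟙 low w * deg G w)  ≤⟨ ∑-mono-≤ bounded ⟩
    ∑[ w < n ] (𝟙 low w * t)        ≡⟨ *-distribʳ-sum t (𝟙 low) ⟨
    count low * t                   ∎
    where
    open ≤-Reasoning
    bounded : ∀ w → 𝟙 low w * deg G w ≤ 𝟙 low w * t
    bounded w with low w in lw
    ... | true  = *-monoʳ-≤ 1 (low⇒deg≤ lw)
    ... | false = z≤n

  clique-outside-lowSet : (∀ a b → a ≢ b → adj G a b ≡ false → deg G a ≤ t ⊎ deg G b ≤ t) →
                          CliqueOutside G lowSet
  clique-outside-lowSet nonadjacent-low a b a∉ b∉ a≢b with adj G a b in ab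
  ... | true  = refl
  ... | false with nonadjacent-low a b a≢b ab
  ...   | inj₁ da≤t = contradiction (trans (sym (deg≤⇒low da≤t)) (∉-tabulate⁻ low a∉)) λ ()
  ...   | inj₂ db≤t = contradiction (trans (sym (deg≤⇒low db≤t)) (∉-tabulate⁻ low b∉)) λ ()

  t≤1+count-low : ∀ z → t + deg G z ≤ n → (∀ w → w ≢ z → adj G z w ≡ false → deg G w ≤ t) →
                  t ≤ suc (count low)
  t≤1+count-low z t+dz≤n non-neighbour-low = +-cancelʳ-≤ (deg G z) t (suc (count low)) (begin
    t + deg G z                                    ≤⟨ t+dz≤n ⟩
    n                                              ≡⟨ non-neighbours+deg≡n G z ⟨
    count (not ∘ adj G z) + deg G z                ≤⟨ +-monoˡ-≤ (deg G z) (∑-mono-≤ covered) ⟩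
    ∑[ w < n ] (𝟙 low w + δ w) + deg G z           ≡⟨ cong (_+ deg G z) (∑-distrib-+ (𝟙 low) δ) ⟩
    count low + ∑[ w < n ] δ w + deg G z           ≡⟨ cong (λ x → count low + x + deg G z) (∑-[≟] z) ⟩
    count low + 1 + deg G z                        ≡⟨ cong (_+ deg G z) (+-comm (count low) 1) ⟩
    suc (count low) + deg G z                      ∎)
    where
    open ≤-Reasoning
    δ : Fin n → ℕ
    δ w = b2n (does (z ≟ w))
    covered : ∀ w → b2n (not (adj G z w)) ≤ 𝟙 low w + δ w
    covered w with z ≟ w
    ... | yes refl rewrite irrefl G z = m≤n+m 1 (𝟙 low z)
    ... | no z≢w with adj G z w in zw
    ...   | true  = z≤n
    ...   | false rewrite deg≤⇒low (non-neighbour-low w (z≢w ∘ sym) zw) = ≤-refl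

module _ {c : ℕ} (G : Graph c) (P : ExtremalPair G)
         (δ≥2 : minDegAtLeast G 2) (closed : Closed (c + 1) G) where

  open ExtremalPair P

  private
    t m q K : ℕ
    t = deg G u
    m = count (low G t)
    q = count (not ∘ low G t)
    K = ⌊ c /2⌋

  t+deg-z≤c : t + deg G z ≤ c
  t+deg-z≤c = ≤-pred (subst (t + deg G z <_) (+-comm c 1) (closed u z u≢z ¬u∼z))
    where
    ¬u∼z : ¬ Adj G u z
    ¬u∼z u∼z = contradiction (trans (sym u∼z) u≁z) λ ()

  t≤K : t ≤ K
  t≤K = subst (_≤ K) (sym (n≡⌊n+n/2⌋ t)) (⌊n/2⌋-mono (≤-trans (+-monoʳ-≤ t deg-u≤deg-z) t+deg-z≤c))

  K+K≤c : K + K ≤ c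
  K+K≤c = subst (K + K ≤_) (⌊n/2⌋+⌈n/2⌉≡n c) (+-monoʳ-≤ K (⌊n/2⌋≤⌈n/2⌉ c))

  c≤1+K+K : c ≤ suc (K + K)
  c≤1+K+K = subst₂ _≤_ (⌊n/2⌋+⌈n/2⌉≡n c) (+-suc K K) (+-monoʳ-≤ K (⌊n/2⌋-mono (n≤1+n (suc c))))

  twice-edges≤pairs : 2 * edges G + q ≤ 2 * (m * t) + q * q
  twice-edges≤pairs =
    ≤-trans (edges≤degSum+pairs G (low G t)) (+-monoˡ-≤ (q * q) (*-monoʳ-≤ 2 (degSum-low≤ G t)))

  twice-edges≤degrees : 2 * edges G + q ≤ m * t + q * c
  twice-edges≤degrees =
    ≤-trans (edges≤degSum+degrees G (low G t)) (+-monoˡ-≤ (q * c) (degSum-low≤ G t))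

  t≤1+m : t ≤ suc m
  t≤1+m = t≤1+count-low G t z t+deg-z≤c non-neighbour-low

  small-degree-sets : ∀ k → k ≤ K → h (c + 1) k < edges G →
    (∃[ s ] ∃[ S ] (2 ≤ s × s ≤ k ∸ 1 × SmallDegSet G s S × CliqueOutside G S))
    ⊎ (∃[ r ] ∃[ T ] (k + 1 ≤ r × r ≤ K × SmallDegSet G r T))
  small-degree-sets k k≤K h<e
    with threshold-cases (count-not+count≡n (low G t)) K+K≤c c≤1+K+K t≤1+m t≤K k≤K
                         twice-edges≤pairs twice-edges≤degrees h<e
  ... | inj₁ m+2≤k = inj₁ (suc m , lowSet G t , ≤-trans (δ≥2 u) t≤1+m , ∸-monoˡ-≤ 1 m+2≤k ,
                           (∣tabulate∣≡count (low G t) , λ w w∈ → ≤-trans (∈lowSet⇒deg≤ G t w∈) t≤1+m) ,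
                           clique-outside-lowSet G t nonadjacent-low)
  ... | inj₂ (r , k<r , r≤K , t≤r , r∸1≤m)
    with ⊆-ofSize (lowSet G t) (r ∸ 1) (subst (r ∸ 1 ≤_) (sym (∣tabulate∣≡count (low G t))) r∸1≤m)
  ...   | T , T⊆low , ∣T∣ =
    inj₂ (r , T , k<r , r≤K , ∣T∣ , λ w w∈ → ≤-trans (∈lowSet⇒deg≤ G t (T⊆low w∈)) t≤r)

lemma2p8 : (c : ℕ) (G : Graph c) (p : ℕ)
    → minDegAtLeast G 2
    → Closed (c + 1) G
    → ¬ HamiltonianConnected G
    → h (c + 1) (⌊ c /2⌋ ∸ p) < edges G
    → (∃[ s ] ∃[ S ] (2 ≤ s × s ≤ (⌊ c /2⌋ ∸ p) ∸ 1 × SmallDegSet G s S × CliqueOutside G S))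
    ⊎ (∃[ t ] ∃[ T ] ((⌊ c /2⌋ ∸ p) + 1 ≤ t × t ≤ ⌊ c /2⌋ × SmallDegSet G t T))
lemma2p8 c G p δ≥2 closed ¬hc h<e with complete⊎extremalPair G
... | inj₁ complete = contradiction (complete⇒hamiltonianConnected G complete) ¬hc
... | inj₂ P = small-degree-sets G P δ≥2 closed (⌊ c /2⌋ ∸ p) (m∸n≤m ⌊ c /2⌋ p) h<e
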